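{- Let $p$ be a prime, let $w_1,w_2$ be positive integers, let $y_1,y_2\in\mathbb{Z}_p$, and let $n\ge0$ be an integer. Then \begin{align*} &\sum_{k=0}^{n}\binom{n}{k}B_{k}(w_{1}y_{1})B_{n-k}(w_{2}y_{2})w_{1}^{n-k}w_{2}^{k} =\sum_{k=0}^{n}\binom{n}{k}B_{k}(w_{2}y_{1})B_{n-k}(w_{1}y_{2})w_{2}^{n-k}w_{1}^{k}\\ &=w_{1}^{n-1}\sum_{k=0}^{n}\binom{n}{k}B_{k}(y_{1})\sum_{i=0}^{w_{1}-1}B_{n-k}\Big(w_{2}y_{2}+\frac{w_{2}}{w_{1}}i\Big)w_{2}^{k}\\ &=w_{1}^{n-1}\sum_{k=0}^{n}\binom{n}{k}B_{k}(w_{2}y_{1})\sum_{i=0}^{w_{1}-1}B_{n-k}\Big(y_{2}+\frac{i}{w_{1}}\Big)w_{2}^{n-k}\\ &=w_{2}^{n-1}\sum_{k=0}^{n}\binom{n}{k}B_{k}(y_{1})\sum_{i=0}^{w_{2}-1}B_{n-k}\Big(w_{1}y_{2}+\frac{w_{1}}{w_{2}}i\Big)w_{1}^{k}\\ &=w_{2}^{n-1}\sum_{k=0}^{n}\binom{n}{k}B_{k}(w_{1}y_{1})\sum_{i=0}^{w_{2}-1}B_{n-k}\Big(y_{2}+\frac{i}{w_{2}}\Big)w_{1}^{n-k}. \end{align*}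
   Context: $\mathbb{Z}_p$ denotes the ring of $p$-adic integers. The Bernoulli polynomials $B_n(x)$ are defined by $\frac{t}{e^t-1}e^{xt}=\sum_{n\ge0}B_n(x)\frac{t^n}{n!}$. -}

module Defs where

open import Level using (Level; _⊔_) renaming (suc to lsuc)
open import Algebra.Bundles using (CommutativeRing)
open import Algebra.Morphism.Structures using (IsRingHomomorphism)
open import Data.Nat using (ℕ; zero; suc; _≤ᵇ_; NonZero) renaming (_^_ to _^ℕ_; _+_ to _+ℕ_)
open import Data.Nat.Combinatorics using (_C_)
open import Data.Integer using (+_)
open import Data.Rational using (ℚ; _/_)
import Data.Rational as ℚ
open import Data.Bool using (if_then_else_)

natℚ : ℕ → ℚ
natℚ n = + n / 1

fracℚ : (a b : ℕ) → .{{_ : NonZero b}} → ℚ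
fracℚ a b = + a / b

-- w ^ (n - 1) as a rational number (so w ^ (0 - 1) = 1 / w).
powPred : (w : ℕ) → .{{_ : NonZero w}} → ℕ → ℚ
powPred w zero = + 1 / w
powPred w (suc m) = natℚ (w ^ℕ m)

-- A ℚ-algebra: a commutative ring together with a ring homomorphism from ℚ.
-- (ℚ_p, with ℤ_p ⊆ ℚ_p, is an example.)
record QAlgebra (c ℓ : Level) : Set (lsuc (c ⊔ ℓ)) where
  field
    cring : CommutativeRing c ℓ
    ι     : ℚ → CommutativeRing.Carrier cring
    ι-hom : IsRingHomomorphism ℚ.+-*-rawRing (CommutativeRing.rawRing cring) ι

  open CommutativeRing cring public

  pow : Carrier → ℕ → Carrier
  pow x zero = 1#
  pow x (suc n) = x * pow x n

  sumTo : ℕ → (ℕ → Carrier) → Carrier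
  sumTo zero f = 0#
  sumTo (suc n) f = sumTo n f + f n

  sumUpTo : ℕ → (ℕ → Carrier) → Carrier
  sumUpTo n f = sumTo (suc n) f

  -- Bernoulli polynomials, defined by t e^{xt}/(e^t - 1) = Σ B_n(x) t^n/n!.
  -- Comparing coefficients of t^{m+1}/(m+1)! in t e^{xt} = (e^t - 1) Σ B_n(x) t^n/n!
  -- gives  Σ_{k=0}^{m} C(m+1,k) B_k(x) = (m+1) x^m,  which determines B_m(x) recursively:
  --   B_m(x) = x^m - (1/(m+1)) Σ_{k<m} C(m+1,k) B_k(x).
  -- bernTable n k = B_k(x) for k ≤ n.
  bernTable : Carrier → ℕ → ℕ → Carrier
  bernTable x zero k = 1#
  bernTable x (suc n) k =
    if k ≤ᵇ n then bernTable x n k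
    else (pow x (suc n) -
          ι (fracℚ 1 (suc (suc n))) *
            sumTo (suc n) (λ j → ι (natℚ ((suc (suc n)) C j)) * bernTable x n j))

  B : ℕ → Carrier → Carrier
  B n x = bernTable x n n

{-# OPTIONS --safe #-}
module Submission where

open import Defs
open import Level using (Level)
open import Data.Nat using (ℕ; NonZero; suc; _∸_; _^_) renaming (_*_ to _*ℕ_)
open import Data.Nat.Combinatorics using (_C_)
open import Data.Nat.Primality using (Prime)
open import Data.Product using (_×_; _,_)

-- Read a sequence (aₙ) as its exponential generating function Σ aₙ tⁿ/n!. The Bernoulli
-- polynomials are then characterised by B(x,t)·eᵗ = B(x,t) + t·e^{xt}, which gives the
-- addition formula B(x + y, t) = B(x,t)·e^{yt} and Raabe's multiplication formula
-- W·B(Wx, t) = B(x, Wt)·Σ_{i<W} e^{it}. Substituting the latter twice,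
--   W·V·B(W y₁, V t)·B(V y₂, W t) = B(y₁, WVt)·B(y₂, WVt)·Σ_{i<W} e^{Vit}·Σ_{j<V} e^{Wjt},
-- which is symmetric in W and V. Each of the five sums is a coefficient of tⁿ/n! of
-- B(W y₁, V t)·B(V y₂, W t) or of its mirror image, once the inner sums over i are read
-- through the multiplication and addition formulas.

module NatCast where
  open import Data.Nat as ℕ using (suc)
  open import Data.Nat.Coprimality as Coprime using (1-coprimeTo)
  open import Data.Integer as ℤ using (+_)
  import Data.Integer.Properties as ℤP
  open import Data.Rational as ℚ using (mkℚ; 1ℚ)
  import Data.Rational.Properties as ℚP
  import Data.Nat.Properties as ℕP
  open import Relation.Binary.PropositionalEquality

  natℚ≡mkℚ : ∀ n → natℚ n ≡ mkℚ (+ n) 0 (Coprime.sym (1-coprimeTo n))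
  natℚ≡mkℚ n = ℚP.normalize-coprime (Coprime.sym (1-coprimeTo n))

  fracℚ1≡mkℚ : ∀ d → fracℚ 1 (suc d) ≡ mkℚ (+ 1) d (1-coprimeTo (suc d))
  fracℚ1≡mkℚ d = ℚP.normalize-coprime (1-coprimeTo (suc d))

  natℚ-+ : ∀ m n → natℚ (m ℕ.+ n) ≡ natℚ m ℚ.+ natℚ n
  natℚ-+ m n = trans (ℚP./-cong (sym (cong₂ ℤ._+_ (ℤP.*-identityʳ (+ m)) (ℤP.*-identityʳ (+ n)))) refl)
                     (sym (cong₂ ℚ._+_ (natℚ≡mkℚ m) (natℚ≡mkℚ n)))

  natℚ-* : ∀ m n → natℚ (m ℕ.* n) ≡ natℚ m ℚ.* natℚ n
  natℚ-* m n = trans (ℚP./-cong {p₂ = + m ℤ.* + n} {q₂ = 1} (ℤP.pos-* m n) refl)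
                     (sym (cong₂ ℚ._*_ (natℚ≡mkℚ m) (natℚ≡mkℚ n)))

  fracℚ1*natℚ≡1 : ∀ d → fracℚ 1 (suc d) ℚ.* natℚ (suc d) ≡ 1ℚ
  fracℚ1*natℚ≡1 d rewrite natℚ≡mkℚ (suc d) | fracℚ1≡mkℚ d =
    ℚP.*-inverseˡ (mkℚ (+ suc d) 0 (Coprime.sym (1-coprimeTo (suc d))))

  fracℚ≡natℚ*fracℚ1 : ∀ a d → fracℚ a (suc d) ≡ natℚ a ℚ.* fracℚ 1 (suc d)
  fracℚ≡natℚ*fracℚ1 a d =
    trans (ℚP./-cong (sym (ℤP.*-identityʳ (+ a))) (sym (ℕP.+-identityʳ (suc d))))
          (sym (cong₂ ℚ._*_ (natℚ≡mkℚ a) (fracℚ1≡mkℚ d)))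

module Binomial where
  open import Data.Nat
  open import Data.Nat.Properties
  open import Data.Nat.DivMod using (m/n*n≡m)
  open import Data.Nat.Combinatorics
  open import Data.Nat.Solver using (module +-*-Solver)
  open import Relation.Binary.PropositionalEquality
  open import Relation.Nullary using (yes; no)
  open +-*-Solver using (solve; _:*_; _:=_)

  nCk*[k!*[n∸k]!]≡n! : ∀ {n k} → k ≤ n → (n C k) * (k ! * (n ∸ k) !) ≡ n !
  nCk*[k!*[n∸k]!]≡n! {n} {k} k≤n =
    trans (cong (_* (k ! * (n ∸ k) !)) (nCk≡n!/k![n-k]! k≤n))
          (m/n*n≡m {{k !* (n ∸ k) !≢0}} (k![n∸k]!∣n! k≤n))

  -- Both sides times j! l! (n ∸ j ∸ l)! are n!.
  nC[j+l]*[j+l]Cj≡nCj*[n∸j]Cl : ∀ n j l → j + l ≤ n →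
    (n C (j + l)) * ((j + l) C j) ≡ (n C j) * ((n ∸ j) C l)
  nC[j+l]*[j+l]Cj≡nCj*[n∸j]Cl n j l j+l≤n =
    *-cancelʳ-≡ _ _ (j ! * (l ! * r !)) {{m*n≢0 _ _ {{j !≢0}} {{m*n≢0 _ _ {{l !≢0}} {{r !≢0}}}}}}
      (trans lhs≡n! (sym rhs≡n!))
    where
    r = n ∸ j ∸ l
    j≤n : j ≤ n
    j≤n = ≤-trans (m≤m+n j l) j+l≤n
    l≤n∸j : l ≤ n ∸ j
    l≤n∸j = subst (_≤ n ∸ j) (m+n∸m≡n j l) (∸-monoˡ-≤ j j+l≤n)
    [j+l]Cj : ((j + l) C j) * (j ! * l !) ≡ (j + l) !
    [j+l]Cj = trans (cong (λ t → ((j + l) C j) * (j ! * t !)) (sym (m+n∸m≡n j l)))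
                    (nCk*[k!*[n∸k]!]≡n! (m≤m+n j l))
    nC[j+l] : (n C (j + l)) * ((j + l) ! * r !) ≡ n !
    nC[j+l] = trans (cong (λ t → (n C (j + l)) * ((j + l) ! * t !)) (∸-+-assoc n j l))
                    (nCk*[k!*[n∸k]!]≡n! j+l≤n)
    lhs≡n! : (n C (j + l)) * ((j + l) C j) * (j ! * (l ! * r !)) ≡ n !
    lhs≡n! = trans (solve 5 (λ a b c d e → a :* b :* (c :* (d :* e)) := a :* ((b :* (c :* d)) :* e)) refl
                      (n C (j + l)) ((j + l) C j) (j !) (l !) (r !))
                   (trans (cong (λ t → (n C (j + l)) * (t * r !)) [j+l]Cj) nC[j+l])
    rhs≡n! : (n C j) * ((n ∸ j) C l) * (j ! * (l ! * r !)) ≡ n !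
    rhs≡n! = trans (solve 5 (λ a b c d e → a :* b :* (c :* (d :* e)) := a :* (c :* (b :* (d :* e)))) refl
                      (n C j) ((n ∸ j) C l) (j !) (l !) (r !))
                   (trans (cong (λ t → (n C j) * (j ! * t)) (nCk*[k!*[n∸k]!]≡n! l≤n∸j))
                          (nCk*[k!*[n∸k]!]≡n! j≤n))

  [1+n]C[1+k]*[1+k]≡[1+n]*nCk : ∀ n k → (suc n C suc k) * suc k ≡ suc n * (n C k)
  [1+n]C[1+k]*[1+k]≡[1+n]*nCk n k with k ≤? n
  ... | yes k≤n = trans (cong ((suc n C suc k) *_) (sym (nC1≡n (suc k))))
                    (trans (nC[j+l]*[j+l]Cj≡nCj*[n∸j]Cl (suc n) 1 k (s≤s k≤n))
                           (cong (_* (n C k)) (nC1≡n (suc n))))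
  ... | no k≰n = trans (cong (_* suc k) (k>n⇒nCk≡0 (s≤s (≰⇒> k≰n))))
                   (trans (sym (*-zeroʳ (suc n))) (cong (suc n *_) (sym (k>n⇒nCk≡0 (≰⇒> k≰n)))))

  [1+n]Cn≡1+n : ∀ n → suc n C n ≡ suc n
  [1+n]Cn≡1+n n = trans (nCk≡nC[n∸k] (n≤1+n n)) (trans (cong (suc n C_) (m+n∸n≡m 1 n)) (nC1≡n (suc n)))

module Arithmetic {c ℓ} (A : QAlgebra c ℓ) where
  open NatCast
  open import Data.Nat as ℕ using (ℕ; zero; suc; _∸_)
    renaming (_+_ to _+ℕ_; _*_ to _*ℕ_; _≤_ to _≤ℕ_; _^_ to _^ℕ_)
  import Data.Nat.Properties as ℕP
  import Relation.Binary.PropositionalEquality as ≡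
  open import Algebra.Morphism.Structures using (module IsRingHomomorphism)
  open QAlgebra A
  open IsRingHomomorphism ι-hom using (+-homo; *-homo; 0#-homo; 1#-homo)
  open import Algebra.Solver.Ring.NaturalCoefficients.Default commutativeSemiring
    using (solve; _:=_; _:*_)

  nat : ℕ → Carrier
  nat n = ι (natℚ n)

  nat-0 : nat 0 ≈ 0#
  nat-0 = 0#-homo

  nat-1 : nat 1 ≈ 1#
  nat-1 = 1#-homo

  nat-+ : ∀ m n → nat (m +ℕ n) ≈ nat m + nat n
  nat-+ m n = trans (reflexive (≡.cong ι (natℚ-+ m n))) (+-homo _ _)

  nat-* : ∀ m n → nat (m *ℕ n) ≈ nat m * nat n
  nat-* m n = trans (reflexive (≡.cong ι (natℚ-* m n))) (*-homo _ _)

  nat-suc : ∀ n → nat (suc n) ≈ nat n + 1#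
  nat-suc n = trans (nat-+ 1 n) (trans (+-congʳ nat-1) (+-comm 1# (nat n)))

  invSuc : ℕ → Carrier
  invSuc d = ι (fracℚ 1 (suc d))

  invSuc-inverseˡ : ∀ d → invSuc d * nat (suc d) ≈ 1#
  invSuc-inverseˡ d = trans (sym (*-homo _ _)) (trans (reflexive (≡.cong ι (fracℚ1*natℚ≡1 d))) 1#-homo)

  invSuc-inverseʳ : ∀ d → nat (suc d) * invSuc d ≈ 1#
  invSuc-inverseʳ d = trans (*-comm _ _) (invSuc-inverseˡ d)

  invSuc-*-nat-suc : ∀ d a → invSuc d * (nat (suc d) * a) ≈ a
  invSuc-*-nat-suc d a = trans (sym (*-assoc _ _ _)) (trans (*-congʳ (invSuc-inverseˡ d)) (*-identityˡ a))

  nat-suc-*-cancelˡ : ∀ d {a b} → nat (suc d) * a ≈ nat (suc d) * b → a ≈ b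
  nat-suc-*-cancelˡ d {a} {b} eq =
    trans (sym (invSuc-*-nat-suc d a)) (trans (*-congˡ eq) (invSuc-*-nat-suc d b))

  ι-fracℚ : ∀ a d → ι (fracℚ a (suc d)) ≈ nat a * invSuc d
  ι-fracℚ a d = trans (reflexive (≡.cong ι (fracℚ≡natℚ*fracℚ1 a d))) (*-homo _ _)

  nat-suc-*-ι-fracℚ : ∀ a d → nat (suc d) * ι (fracℚ a (suc d)) ≈ nat a
  nat-suc-*-ι-fracℚ a d = trans (*-congˡ (ι-fracℚ a d))
    (trans (solve 3 (λ u x v → u :* (x :* v) := x :* (v :* u)) refl (nat (suc d)) (nat a) (invSuc d))
           (trans (*-congˡ (invSuc-inverseˡ d)) (*-identityʳ _)))

  pow-cong : ∀ {x y} n → x ≈ y → pow x n ≈ pow y n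
  pow-cong zero    x≈y = refl
  pow-cong (suc n) x≈y = *-cong x≈y (pow-cong n x≈y)

  pow-+ : ∀ x m n → pow x (m +ℕ n) ≈ pow x m * pow x n
  pow-+ x zero    n = sym (*-identityˡ _)
  pow-+ x (suc m) n = trans (*-congˡ (pow-+ x m n)) (sym (*-assoc _ _ _))

  pow-split : ∀ x {n k} → k ≤ℕ n → pow x n ≈ pow x k * pow x (n ∸ k)
  pow-split x {n} {k} k≤n =
    trans (reflexive (≡.cong (pow x) (≡.sym (ℕP.m+[n∸m]≡n k≤n)))) (pow-+ x k (n ∸ k))

  pow-* : ∀ x y n → pow (x * y) n ≈ pow x n * pow y n
  pow-* x y zero    = sym (*-identityˡ _)
  pow-* x y (suc n) = trans (*-congˡ (pow-* x y n))
    (solve 4 (λ a b c d → (a :* b) :* (c :* d) := (a :* c) :* (b :* d)) refl x y (pow x n) (pow y n))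

  pow-1# : ∀ n → pow 1# n ≈ 1#
  pow-1# zero    = refl
  pow-1# (suc n) = trans (*-identityˡ _) (pow-1# n)

  nat-^ : ∀ w n → nat (w ^ℕ n) ≈ pow (nat w) n
  nat-^ w zero    = nat-1
  nat-^ w (suc n) = trans (nat-* w (w ^ℕ n)) (*-congˡ (nat-^ w n))

  ι-powPred : ∀ d n → ι (powPred (suc d) n) ≈ invSuc d * pow (nat (suc d)) n
  ι-powPred d zero    = sym (*-identityʳ _)
  ι-powPred d (suc n) = trans (nat-^ (suc d) n) (sym (invSuc-*-nat-suc d _))

module Sums {c ℓ} (A : QAlgebra c ℓ) where
  open import Data.Nat as ℕ using (ℕ; zero; suc; _∸_)
    renaming (_+_ to _+ℕ_; _<_ to _<ℕ_)
  import Data.Nat.Properties as ℕP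
  import Relation.Binary.PropositionalEquality as ≡
  open QAlgebra A
  open import Relation.Binary.Reasoning.Setoid setoid
  open import Algebra.Solver.Ring.NaturalCoefficients.Default commutativeSemiring
    using (solve; _:=_; _:+_)

  sumTo-cong< : ∀ N {f g : ℕ → Carrier} → (∀ k → k <ℕ N → f k ≈ g k) → sumTo N f ≈ sumTo N g
  sumTo-cong< zero    f≈g = refl
  sumTo-cong< (suc N) f≈g =
    +-cong (sumTo-cong< N (λ k k<N → f≈g k (ℕP.m<n⇒m<1+n k<N))) (f≈g N (ℕP.n<1+n N))

  sumTo-cong : ∀ N {f g : ℕ → Carrier} → (∀ k → f k ≈ g k) → sumTo N f ≈ sumTo N g
  sumTo-cong N f≈g = sumTo-cong< N (λ k _ → f≈g k)

  sumTo-≡ : ∀ {N M} (f : ℕ → Carrier) → N ≡.≡ M → sumTo N f ≈ sumTo M f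
  sumTo-≡ f ≡.refl = refl

  sumTo-0# : ∀ N → sumTo N (λ _ → 0#) ≈ 0#
  sumTo-0# zero    = refl
  sumTo-0# (suc N) = trans (+-identityʳ _) (sumTo-0# N)

  sumTo-+ : ∀ N (f g : ℕ → Carrier) → sumTo N (λ k → f k + g k) ≈ sumTo N f + sumTo N g
  sumTo-+ zero    f g = sym (+-identityˡ _)
  sumTo-+ (suc N) f g = trans (+-congʳ (sumTo-+ N f g))
    (solve 4 (λ a b c d → (a :+ b) :+ (c :+ d) := (a :+ c) :+ (b :+ d)) refl
       (sumTo N f) (sumTo N g) (f N) (g N))

  sumTo-*ˡ : ∀ N x (f : ℕ → Carrier) → x * sumTo N f ≈ sumTo N (λ k → x * f k)
  sumTo-*ˡ zero    x f = zeroʳ x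
  sumTo-*ˡ (suc N) x f = trans (distribˡ x _ _) (+-congʳ (sumTo-*ˡ N x f))

  sumTo-*ʳ : ∀ N x (f : ℕ → Carrier) → sumTo N f * x ≈ sumTo N (λ k → f k * x)
  sumTo-*ʳ N x f = trans (*-comm _ _) (trans (sumTo-*ˡ N x f) (sumTo-cong N (λ k → *-comm x (f k))))

  sumTo-head : ∀ N (f : ℕ → Carrier) → sumTo (suc N) f ≈ f 0 + sumTo N (λ k → f (suc k))
  sumTo-head zero    f = trans (+-identityˡ _) (sym (+-identityʳ _))
  sumTo-head (suc N) f = trans (+-congʳ (sumTo-head N f)) (+-assoc _ _ _)

  sumTo-reverse : ∀ N (f : ℕ → Carrier) → sumTo N f ≈ sumTo N (λ k → f (N ∸ suc k))
  sumTo-reverse zero    f = refl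
  sumTo-reverse (suc N) f = trans (+-comm _ _) (trans (+-congˡ (sumTo-reverse N f))
    (sym (sumTo-head N (λ k → f (N ∸ k)))))

  sumTo-telescope : ∀ N (f : ℕ → Carrier) → sumTo N (λ i → f (suc i)) + f 0 ≈ sumTo N f + f N
  sumTo-telescope zero    f = trans (+-identityˡ _) (sym (+-identityˡ _))
  sumTo-telescope (suc N) f =
    trans (solve 3 (λ a b c → (a :+ b) :+ c := (a :+ c) :+ b) refl _ _ _)
          (+-congʳ (sumTo-telescope N f))

  sumTo-triangle : ∀ N (h : ℕ → ℕ → Carrier) →
    sumTo N (λ k → sumTo (suc k) (λ j → h j k)) ≈ sumTo N (λ j → sumTo (N ∸ j) (λ l → h j (j +ℕ l)))
  sumTo-triangle zero    h = refl
  sumTo-triangle (suc N) h = begin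
      sumTo N (λ k → sumTo (suc k) (λ j → h j k)) + (sumTo N (λ j → h j N) + h N N)
    ≈⟨ +-congʳ (sumTo-triangle N h) ⟩
      sumTo N (λ j → sumTo (N ∸ j) (λ l → h j (j +ℕ l))) + (sumTo N (λ j → h j N) + h N N)
    ≈⟨ +-assoc _ _ _ ⟨
      (sumTo N (λ j → sumTo (N ∸ j) (λ l → h j (j +ℕ l))) + sumTo N (λ j → h j N)) + h N N
    ≈⟨ +-cong (sym (sumTo-+ N _ _)) (sym diagonal) ⟩
      sumTo N (λ j → sumTo (N ∸ j) (λ l → h j (j +ℕ l)) + h j N)
        + sumTo (suc N ∸ N) (λ l → h N (N +ℕ l))
    ≈⟨ +-congʳ (sumTo-cong< N extendRow) ⟩
      sumTo N (λ j → sumTo (suc N ∸ j) (λ l → h j (j +ℕ l)))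
        + sumTo (suc N ∸ N) (λ l → h N (N +ℕ l))
    ∎
    where
    diagonal : sumTo (suc N ∸ N) (λ l → h N (N +ℕ l)) ≈ h N N
    diagonal = trans (sumTo-≡ _ (ℕP.m+n∸n≡m 1 N))
      (trans (+-identityˡ _) (reflexive (≡.cong (h N) (ℕP.+-identityʳ N))))
    extendRow : ∀ j → j <ℕ N →
      sumTo (N ∸ j) (λ l → h j (j +ℕ l)) + h j N ≈ sumTo (suc N ∸ j) (λ l → h j (j +ℕ l))
    extendRow j j<N = sym (trans (sumTo-≡ _ (ℕP.+-∸-assoc 1 (ℕP.<⇒≤ j<N)))
      (+-congˡ (reflexive (≡.cong (h j) (ℕP.m+[n∸m]≡n (ℕP.<⇒≤ j<N))))))

-- On generating functions, a ⋆ b is the product, exp x is e^{xt}, dilate u a is a(ut)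
-- and t* a is t·a(t).
module EGF {c ℓ} (A : QAlgebra c ℓ) where
  open Binomial
  open Arithmetic A
  open Sums A
  open import Data.Nat as ℕ using (ℕ; zero; suc; _∸_; s≤s)
    renaming (_+_ to _+ℕ_; _≤_ to _≤ℕ_; _<_ to _<ℕ_)
  import Data.Nat.Properties as ℕP
  open import Data.Nat.Combinatorics
    using (_C_; nCk≡nC[n∸k]; nCn≡1; k>n⇒nCk≡0; nCk+nC[k+1]≡[n+1]C[k+1])
  import Relation.Binary.PropositionalEquality as ≡
  open import Relation.Binary.Bundles using (Setoid)
  import Relation.Binary.Reasoning.Setoid as SetoidReasoning
  open QAlgebra A
  open import Algebra.Properties.AbelianGroup +-abelianGroup using (∙-cancelʳ)
  open import Algebra.Solver.Ring.NaturalCoefficients.Default commutativeSemiring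
    using (solve; _:=_; _:+_; _:*_)

  Seq : Set c
  Seq = ℕ → Carrier

  infix 4 _≋_
  _≋_ : Seq → Seq → Set ℓ
  a ≋ b = ∀ n → a n ≈ b n

  ≋-setoid : Setoid c ℓ
  ≋-setoid = record
    { _≈_           = _≋_
    ; isEquivalence = record
      { refl  = λ _ → refl
      ; sym   = λ a≋b n → sym (a≋b n)
      ; trans = λ a≋b b≋d n → trans (a≋b n) (b≋d n)
      }
    }

  open Setoid ≋-setoid public using () renaming (refl to ≋-refl; sym to ≋-sym; trans to ≋-trans)
  module ≈-Reasoning = SetoidReasoning setoid
  module ≋-Reasoning = SetoidReasoning ≋-setoid

  infixl 6 _⊕_
  infixr 8 _·_
  infixl 7 _⋆_

  _⊕_ : Seq → Seq → Seq
  (a ⊕ b) n = a n + b n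

  _·_ : Carrier → Seq → Seq
  (x · a) n = x * a n

  _⋆_ : Seq → Seq → Seq
  (a ⋆ b) n = sumTo (suc n) (λ k → nat (n C k) * a k * b (n ∸ k))

  sumSeq : ℕ → (ℕ → Seq) → Seq
  sumSeq N a n = sumTo N (λ i → a i n)

  exp : Carrier → Seq
  exp x n = pow x n

  dilate : Carrier → Seq → Seq
  dilate u a n = pow u n * a n

  t*_ : Seq → Seq
  (t* a) zero    = 0#
  (t* a) (suc n) = nat (suc n) * a n

  ⊕-cong : ∀ {a a′ b b′} → a ≋ a′ → b ≋ b′ → a ⊕ b ≋ a′ ⊕ b′
  ⊕-cong a≋a′ b≋b′ n = +-cong (a≋a′ n) (b≋b′ n)

  ·-cong : ∀ {x x′ a a′} → x ≈ x′ → a ≋ a′ → x · a ≋ x′ · a′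
  ·-cong x≈x′ a≋a′ n = *-cong x≈x′ (a≋a′ n)

  ⊕-cancelʳ : ∀ {a b} d → a ⊕ d ≋ b ⊕ d → a ≋ b
  ⊕-cancelʳ d a+d≋b+d n = ∙-cancelʳ (d n) _ _ (a+d≋b+d n)

  ·-assoc : ∀ x y a → x · y · a ≋ (x * y) · a
  ·-assoc x y a n = sym (*-assoc x y (a n))

  ·-distrib-⊕ : ∀ x a b → x · (a ⊕ b) ≋ x · a ⊕ x · b
  ·-distrib-⊕ x a b n = distribˡ x (a n) (b n)

  exp-cong : ∀ {x y} → x ≈ y → exp x ≋ exp y
  exp-cong x≈y n = pow-cong n x≈y

  dilate-cong : ∀ {u u′ a a′} → u ≈ u′ → a ≋ a′ → dilate u a ≋ dilate u′ a′
  dilate-cong u≈u′ a≋a′ n = *-cong (pow-cong n u≈u′) (a≋a′ n)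

  dilate-congʳ : ∀ a {u u′} → u ≈ u′ → dilate u a ≋ dilate u′ a
  dilate-congʳ a u≈u′ = dilate-cong u≈u′ (≋-refl {a})

  t*-cong : ∀ {a b} → a ≋ b → t* a ≋ t* b
  t*-cong a≋b zero    = refl
  t*-cong a≋b (suc n) = *-congˡ (a≋b n)

  ⋆-cong : ∀ {a a′ b b′} → a ≋ a′ → b ≋ b′ → a ⋆ b ≋ a′ ⋆ b′
  ⋆-cong a≋a′ b≋b′ n = sumTo-cong (suc n) (λ k → *-cong (*-congˡ (a≋a′ k)) (b≋b′ (n ∸ k)))

  ⋆-congˡ : ∀ a {b b′} → b ≋ b′ → a ⋆ b ≋ a ⋆ b′
  ⋆-congˡ a = ⋆-cong (≋-refl {a})

  ⋆-congʳ : ∀ b {a a′} → a ≋ a′ → a ⋆ b ≋ a′ ⋆ b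
  ⋆-congʳ b a≋a′ = ⋆-cong a≋a′ (≋-refl {b})

  ⋆-comm : ∀ a b → a ⋆ b ≋ b ⋆ a
  ⋆-comm a b n = trans (sumTo-reverse (suc n) _) (sumTo-cong< (suc n) reflected)
    where
    reflected : ∀ k → k <ℕ suc n →
      nat (n C (n ∸ k)) * a (n ∸ k) * b (n ∸ (n ∸ k)) ≈ nat (n C k) * b k * a (n ∸ k)
    reflected k (s≤s k≤n) =
      trans (*-cong (*-congʳ (reflexive (≡.cong nat (≡.sym (nCk≡nC[n∸k] k≤n)))))
                    (reflexive (≡.cong b (ℕP.m∸[m∸n]≡n k≤n))))
            (solve 3 (λ x y z → x :* y :* z := x :* z :* y) refl _ _ _)

  ⋆-distribʳ-⊕ : ∀ a a′ b → (a ⊕ a′) ⋆ b ≋ a ⋆ b ⊕ a′ ⋆ b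
  ⋆-distribʳ-⊕ a a′ b n = trans (sumTo-cong (suc n) (λ k →
      solve 4 (λ x y z w → x :* (y :+ z) :* w := x :* y :* w :+ x :* z :* w) refl
        (nat (n C k)) (a k) (a′ k) (b (n ∸ k))))
    (sumTo-+ (suc n) _ _)

  ⋆-distribˡ-⊕ : ∀ a b b′ → a ⋆ (b ⊕ b′) ≋ a ⋆ b ⊕ a ⋆ b′
  ⋆-distribˡ-⊕ a b b′ n =
    trans (⋆-comm a _ n) (trans (⋆-distribʳ-⊕ b b′ a n) (+-cong (⋆-comm b a n) (⋆-comm b′ a n)))

  ⋆-·ˡ : ∀ x a b → (x · a) ⋆ b ≋ x · (a ⋆ b)
  ⋆-·ˡ x a b n = trans (sumTo-cong (suc n) (λ k →
      solve 4 (λ p y z w → p :* (y :* z) :* w := y :* (p :* z :* w)) refl (nat (n C k)) x (a k) (b (n ∸ k))))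
    (sym (sumTo-*ˡ (suc n) x _))

  ⋆-·ʳ : ∀ x a b → a ⋆ (x · b) ≋ x · (a ⋆ b)
  ⋆-·ʳ x a b n = trans (⋆-comm a _ n) (trans (⋆-·ˡ x b a n) (*-congˡ (⋆-comm b a n)))

  ⋆-sumSeqˡ : ∀ N (a : ℕ → Seq) b → sumSeq N a ⋆ b ≋ sumSeq N (λ i → a i ⋆ b)
  ⋆-sumSeqˡ zero    a b n = trans (sumTo-cong (suc n) (λ k → trans (*-congʳ (zeroʳ _)) (zeroˡ _)))
                                  (sumTo-0# (suc n))
  ⋆-sumSeqˡ (suc N) a b n = trans (⋆-distribʳ-⊕ (sumSeq N a) (a N) b n) (+-congʳ (⋆-sumSeqˡ N a b n))

  ⋆-sumSeqʳ : ∀ N a (b : ℕ → Seq) → a ⋆ sumSeq N b ≋ sumSeq N (λ i → a ⋆ b i)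
  ⋆-sumSeqʳ N a b n =
    trans (⋆-comm a _ n) (trans (⋆-sumSeqˡ N b a n) (sumTo-cong N (λ i → ⋆-comm (b i) a n)))

  ⋆-assoc : ∀ a b d → (a ⋆ b) ⋆ d ≋ a ⋆ (b ⋆ d)
  ⋆-assoc a b d n = begin
      sumTo (suc n) (λ k → nat (n C k) * (a ⋆ b) k * d (n ∸ k))
    ≈⟨ sumTo-cong (suc n) expand ⟩
      sumTo (suc n) (λ k → sumTo (suc k) (λ j → h j k))
    ≈⟨ sumTo-triangle (suc n) h ⟩
      sumTo (suc n) (λ j → sumTo (suc n ∸ j) (λ l → h j (j +ℕ l)))
    ≈⟨ sumTo-cong< (suc n) collect ⟩
      sumTo (suc n) (λ j → nat (n C j) * a j * (b ⋆ d) (n ∸ j))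
    ∎
    where
    open ≈-Reasoning
    h : ℕ → ℕ → Carrier
    h j k = nat (n C k) * (nat (k C j) * a j * b (k ∸ j)) * d (n ∸ k)
    expand : ∀ k → nat (n C k) * (a ⋆ b) k * d (n ∸ k) ≈ sumTo (suc k) (λ j → h j k)
    expand k = trans (*-congʳ (sumTo-*ˡ (suc k) _ _)) (sumTo-*ʳ (suc k) _ _)
    regroup : ∀ j l → j +ℕ l ≤ℕ n →
      h j (j +ℕ l) ≈ nat (n C j) * a j * (nat ((n ∸ j) C l) * b l * d (n ∸ j ∸ l))
    regroup j l j+l≤n = begin
        nat (n C (j +ℕ l)) * (nat ((j +ℕ l) C j) * a j * b (j +ℕ l ∸ j)) * d (n ∸ (j +ℕ l))
      ≈⟨ *-cong (*-congˡ (*-congˡ (reflexive (≡.cong b (ℕP.m+n∸m≡n j l)))))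
                (reflexive (≡.cong d (≡.sym (ℕP.∸-+-assoc n j l)))) ⟩
        nat (n C (j +ℕ l)) * (nat ((j +ℕ l) C j) * a j * b l) * d (n ∸ j ∸ l)
      ≈⟨ solve 5 (λ p q x y z → p :* (q :* x :* y) :* z := (p :* q) :* (x :* y :* z)) refl _ _ _ _ _ ⟩
        (nat (n C (j +ℕ l)) * nat ((j +ℕ l) C j)) * (a j * b l * d (n ∸ j ∸ l))
      ≈⟨ *-congʳ binomials ⟩
        (nat (n C j) * nat ((n ∸ j) C l)) * (a j * b l * d (n ∸ j ∸ l))
      ≈⟨ solve 5 (λ p q x y z → (p :* q) :* (x :* y :* z) := p :* x :* (q :* y :* z)) refl _ _ _ _ _ ⟩
        nat (n C j) * a j * (nat ((n ∸ j) C l) * b l * d (n ∸ j ∸ l))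
      ∎
      where
      binomials : nat (n C (j +ℕ l)) * nat ((j +ℕ l) C j) ≈ nat (n C j) * nat ((n ∸ j) C l)
      binomials = trans (sym (nat-* (n C (j +ℕ l)) ((j +ℕ l) C j)))
        (trans (reflexive (≡.cong nat (nC[j+l]*[j+l]Cj≡nCj*[n∸j]Cl n j l j+l≤n)))
               (nat-* (n C j) ((n ∸ j) C l)))
    collect : ∀ j → j <ℕ suc n →
      sumTo (suc n ∸ j) (λ l → h j (j +ℕ l)) ≈ nat (n C j) * a j * (b ⋆ d) (n ∸ j)
    collect j (s≤s j≤n) = begin
        sumTo (suc n ∸ j) (λ l → h j (j +ℕ l))
      ≈⟨ sumTo-≡ _ (ℕP.+-∸-assoc 1 j≤n) ⟩
        sumTo (suc (n ∸ j)) (λ l → h j (j +ℕ l))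
      ≈⟨ sumTo-cong< (suc (n ∸ j)) (λ l l≤n∸j → regroup j l (j+l≤n l≤n∸j)) ⟩
        sumTo (suc (n ∸ j)) (λ l → nat (n C j) * a j * (nat ((n ∸ j) C l) * b l * d (n ∸ j ∸ l)))
      ≈⟨ sumTo-*ˡ (suc (n ∸ j)) _ _ ⟨
        nat (n C j) * a j * (b ⋆ d) (n ∸ j)
      ∎
      where
      j+l≤n : ∀ {l} → l <ℕ suc (n ∸ j) → j +ℕ l ≤ℕ n
      j+l≤n (s≤s l≤n∸j) = ≡.subst (j +ℕ _ ≤ℕ_) (ℕP.m+[n∸m]≡n j≤n) (ℕP.+-monoʳ-≤ j l≤n∸j)

  ⋆-four-swap : ∀ a b d e → (a ⋆ b) ⋆ (d ⋆ e) ≋ (a ⋆ d) ⋆ (b ⋆ e)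
  ⋆-four-swap a b d e = begin
      (a ⋆ b) ⋆ (d ⋆ e)  ≈⟨ ⋆-assoc a b (d ⋆ e) ⟩
      a ⋆ (b ⋆ (d ⋆ e))  ≈⟨ ⋆-congˡ a (≋-sym (⋆-assoc b d e)) ⟩
      a ⋆ ((b ⋆ d) ⋆ e)  ≈⟨ ⋆-congˡ a (⋆-congʳ e (⋆-comm b d)) ⟩
      a ⋆ ((d ⋆ b) ⋆ e)  ≈⟨ ⋆-congˡ a (⋆-assoc d b e) ⟩
      a ⋆ (d ⋆ (b ⋆ e))  ≈⟨ ≋-sym (⋆-assoc a d (b ⋆ e)) ⟩
      (a ⋆ d) ⋆ (b ⋆ e)  ∎
    where open ≋-Reasoning

  ⋆-identityʳ : ∀ a → a ⋆ exp 0# ≋ a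
  ⋆-identityʳ a n = begin
      sumTo n f + f n
    ≈⟨ +-cong (sumTo-cong< n (λ k k<n → trans (*-congˡ (vanishes k<n)) (zeroʳ _))) last ⟩
      sumTo n (λ _ → 0#) + a n
    ≈⟨ trans (+-congʳ (sumTo-0# n)) (+-identityˡ _) ⟩
      a n
    ∎
    where
    open ≈-Reasoning
    f : ℕ → Carrier
    f k = nat (n C k) * a k * pow 0# (n ∸ k)
    vanishes : ∀ {k} → k <ℕ n → pow 0# (n ∸ k) ≈ 0#
    vanishes k<n = trans (reflexive (≡.cong (pow 0#) (ℕP.+-∸-assoc 1 k<n))) (zeroˡ _)
    last : f n ≈ a n
    last = begin
        nat (n C n) * a n * pow 0# (n ∸ n)
      ≈⟨ *-cong (*-congʳ (trans (reflexive (≡.cong nat (nCn≡1 n))) nat-1))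
                (reflexive (≡.cong (pow 0#) (ℕP.n∸n≡0 n))) ⟩
        1# * a n * 1#
      ≈⟨ trans (*-identityʳ _) (*-identityˡ _) ⟩
        a n
      ∎

  t*-⋆ : ∀ a b → (t* a) ⋆ b ≋ t* (a ⋆ b)
  t*-⋆ a b zero    = trans (+-identityˡ _) (trans (*-congʳ (zeroʳ _)) (zeroˡ _))
  t*-⋆ a b (suc m) = begin
      sumTo (suc (suc m)) f
    ≈⟨ sumTo-head (suc m) f ⟩
      f 0 + sumTo (suc m) (λ k → f (suc k))
    ≈⟨ +-cong (trans (*-congʳ (zeroʳ _)) (zeroˡ _)) (sumTo-cong (suc m) absorb) ⟩
      0# + sumTo (suc m) (λ k → nat (suc m) * (nat (m C k) * a k * b (m ∸ k)))
    ≈⟨ trans (+-identityˡ _) (sym (sumTo-*ˡ (suc m) _ _)) ⟩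
      nat (suc m) * (a ⋆ b) m
    ∎
    where
    open ≈-Reasoning
    f : ℕ → Carrier
    f k = nat (suc m C k) * (t* a) k * b (suc m ∸ k)
    binomials : ∀ k → nat (suc m C suc k) * nat (suc k) ≈ nat (suc m) * nat (m C k)
    binomials k = trans (sym (nat-* (suc m C suc k) (suc k)))
      (trans (reflexive (≡.cong nat ([1+n]C[1+k]*[1+k]≡[1+n]*nCk m k))) (nat-* (suc m) (m C k)))
    absorb : ∀ k → f (suc k) ≈ nat (suc m) * (nat (m C k) * a k * b (m ∸ k))
    absorb k = begin
        nat (suc m C suc k) * (nat (suc k) * a k) * b (m ∸ k)
      ≈⟨ solve 4 (λ p q x y → p :* (q :* x) :* y := (p :* q) :* (x :* y)) refl _ _ _ _ ⟩
        (nat (suc m C suc k) * nat (suc k)) * (a k * b (m ∸ k))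
      ≈⟨ *-congʳ (binomials k) ⟩
        (nat (suc m) * nat (m C k)) * (a k * b (m ∸ k))
      ≈⟨ solve 4 (λ p q x y → (p :* q) :* (x :* y) := p :* (q :* x :* y)) refl _ _ _ _ ⟩
        nat (suc m) * (nat (m C k) * a k * b (m ∸ k))
      ∎

  exp-+ : ∀ x y → exp x ⋆ exp y ≋ exp (x + y)
  exp-+ x y zero    = trans (+-identityˡ _) (trans (*-identityʳ _) (trans (*-identityʳ _) nat-1))
  exp-+ x y (suc m) = begin
      sumTo (suc (suc m)) g
    ≈⟨ sumTo-head (suc m) g ⟩
      g 0 + sumTo (suc m) (λ k → g (suc k))
    ≈⟨ +-congˡ (trans (sumTo-cong (suc m) pascal) (sumTo-+ (suc m) _ _)) ⟩
      g 0 + (sumTo (suc m) (λ k → nat (m C k) * pow x (suc k) * pow y (m ∸ k)) + yTerms)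
    ≈⟨ solve 3 (λ p q r → p :+ (q :+ r) := q :+ (p :+ r)) refl _ _ _ ⟩
      sumTo (suc m) (λ k → nat (m C k) * pow x (suc k) * pow y (m ∸ k)) + (g 0 + yTerms)
    ≈⟨ +-cong xPart yPart ⟩
      x * (exp x ⋆ exp y) m + y * (exp x ⋆ exp y) m
    ≈⟨ distribʳ _ x y ⟨
      (x + y) * (exp x ⋆ exp y) m
    ≈⟨ *-congˡ (exp-+ x y m) ⟩
      (x + y) * pow (x + y) m
    ∎
    where
    open ≈-Reasoning
    g : ℕ → Carrier
    g k = nat (suc m C k) * pow x k * pow y (suc m ∸ k)
    yTerms : Carrier
    yTerms = sumTo (suc m) (λ k → nat (m C suc k) * pow x (suc k) * pow y (m ∸ k))
    pascal : ∀ k → g (suc k) ≈ nat (m C k) * pow x (suc k) * pow y (m ∸ k)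
                                + nat (m C suc k) * pow x (suc k) * pow y (m ∸ k)
    pascal k = trans (*-congʳ (*-congʳ (trans (reflexive (≡.cong nat (≡.sym (nCk+nC[k+1]≡[n+1]C[k+1] m k))))
                                              (nat-+ (m C k) (m C suc k)))))
      (solve 4 (λ p q r s → (p :+ q) :* r :* s := p :* r :* s :+ q :* r :* s) refl _ _ _ _)
    xPart : sumTo (suc m) (λ k → nat (m C k) * pow x (suc k) * pow y (m ∸ k)) ≈ x * (exp x ⋆ exp y) m
    xPart = trans (sumTo-cong (suc m) (λ k →
        solve 4 (λ p q r s → p :* (q :* r) :* s := q :* (p :* r :* s)) refl _ _ _ _))
      (sym (sumTo-*ˡ (suc m) x _))
    h : ℕ → Carrier
    h k = nat (m C k) * pow x k * pow y (suc m ∸ k)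
    yPart : g 0 + yTerms ≈ y * (exp x ⋆ exp y) m
    yPart = begin
        g 0 + yTerms
      ≈⟨ sumTo-head (suc m) h ⟨
        sumTo (suc m) h + h (suc m)
      ≈⟨ +-congˡ (trans (*-congʳ (*-congʳ (trans (reflexive (≡.cong nat (k>n⇒nCk≡0 (ℕP.n<1+n m)))) nat-0)))
                        (trans (*-congʳ (zeroˡ _)) (zeroˡ _))) ⟩
        sumTo (suc m) h + 0#
      ≈⟨ +-identityʳ _ ⟩
        sumTo (suc m) h
      ≈⟨ sumTo-cong< (suc m) (λ k k≤m →
           trans (*-congˡ (reflexive (≡.cong (pow y) (ℕP.+-∸-assoc 1 {m} {k} (ℕP.≤-pred k≤m)))))
                 (solve 4 (λ p q r s → p :* q :* (r :* s) := r :* (p :* q :* s)) refl _ _ _ _)) ⟩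
        sumTo (suc m) (λ k → y * (nat (m C k) * pow x k * pow y (m ∸ k)))
      ≈⟨ sumTo-*ˡ (suc m) y _ ⟨
        y * (exp x ⋆ exp y) m
      ∎

  dilate-⋆ : ∀ u a b → dilate u (a ⋆ b) ≋ dilate u a ⋆ dilate u b
  dilate-⋆ u a b n = trans (sumTo-*ˡ (suc n) _ _) (sumTo-cong< (suc n) spread)
    where
    spread : ∀ k → k <ℕ suc n →
      pow u n * (nat (n C k) * a k * b (n ∸ k)) ≈ nat (n C k) * (pow u k * a k) * (pow u (n ∸ k) * b (n ∸ k))
    spread k (s≤s k≤n) = trans (*-congʳ (pow-split u k≤n))
      (solve 5 (λ p q x y z → (p :* q) :* (x :* y :* z) := x :* (p :* y) :* (q :* z)) refl _ _ _ _ _)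

  dilate-exp : ∀ u x → dilate u (exp x) ≋ exp (u * x)
  dilate-exp u x n = sym (pow-* u x n)

  dilate-⊕ : ∀ u a b → dilate u (a ⊕ b) ≋ dilate u a ⊕ dilate u b
  dilate-⊕ u a b n = distribˡ (pow u n) (a n) (b n)

  dilate-dilate : ∀ u v a → dilate u (dilate v a) ≋ dilate (u * v) a
  dilate-dilate u v a n = trans (sym (*-assoc _ _ _)) (*-congʳ (sym (pow-* u v n)))

  dilate-· : ∀ u x a → dilate u (x · a) ≋ x · dilate u a
  dilate-· u x a n = solve 3 (λ p q r → p :* (q :* r) := q :* (p :* r)) refl (pow u n) x (a n)

  dilate-sumSeq : ∀ u N (a : ℕ → Seq) → dilate u (sumSeq N a) ≋ sumSeq N (λ i → dilate u (a i))
  dilate-sumSeq u N a n = sumTo-*ˡ N (pow u n) _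

  dilate-t* : ∀ u a → dilate u (t* a) ≋ u · t* (dilate u a)
  dilate-t* u a zero    = trans (zeroʳ _) (sym (zeroʳ _))
  dilate-t* u a (suc m) =
    solve 4 (λ p q x y → (p :* q) :* (x :* y) := p :* (x :* (q :* y))) refl u (pow u m) (nat (suc m)) (a m)

module Bernoulli {c ℓ} (A : QAlgebra c ℓ) where
  open Binomial
  open Arithmetic A
  open Sums A
  open EGF A
  open import Data.Nat as ℕ using (ℕ; zero; suc; _∸_; s≤s; _<ᵇ_)
    renaming (_≤_ to _≤ℕ_; _<_ to _<ℕ_)
  import Data.Nat.Properties as ℕP
  open import Data.Nat.Combinatorics using (_C_; nCn≡1)
  open import Data.Bool using (false)
  open import Data.Bool.Properties using (if-cong; T-≡)
  open import Data.Sum using (inj₁; inj₂)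
  open import Function.Bundles using (Equivalence)
  import Relation.Binary.PropositionalEquality as ≡
  open QAlgebra A
  open import Algebra.Properties.AbelianGroup +-abelianGroup using (∙-cancelˡ; ∙-cancelʳ)
  open import Algebra.Properties.Ring ring using (-‿distribʳ-*)

  bern : Carrier → Seq
  bern x n = B n x

  -- Q(t)·eᵗ = Q(t) + t·e^{xt}, the defining equation of t e^{xt}/(eᵗ - 1).
  IsBernoulliEGF : Carrier → Seq → Set ℓ
  IsBernoulliEGF x Q = Q ⋆ exp 1# ≋ Q ⊕ t* exp x

  BernoulliRecurrence : Carrier → Seq → Set ℓ
  BernoulliRecurrence x Q = ∀ m → sumTo (suc m) (λ k → nat (suc m C k) * Q k) ≈ nat (suc m) * pow x m

  n<ᵇn≡false : ∀ n → (n <ᵇ n) ≡.≡ false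
  n<ᵇn≡false zero    = ≡.refl
  n<ᵇn≡false (suc n) = n<ᵇn≡false n

  bernTable-stable : ∀ x {n k} → k ≤ℕ n → bernTable x n k ≡.≡ B k x
  bernTable-stable x {zero}  ℕ.z≤n = ≡.refl
  bernTable-stable x {suc n} k≤1+n with ℕP.m≤n⇒m<n∨m≡n k≤1+n
  ... | inj₁ (s≤s k≤n) =
    ≡.trans (if-cong (Equivalence.to T-≡ (ℕP.≤⇒≤ᵇ k≤n))) (bernTable-stable x k≤n)
  ... | inj₂ ≡.refl = ≡.refl

  B-suc : ∀ x n → B (suc n) x ≈
    pow x (suc n) - invSuc (suc n) * sumTo (suc n) (λ j → nat (suc (suc n) C j) * B j x)
  B-suc x n = trans (reflexive (if-cong (n<ᵇn≡false n)))
    (+-congˡ (-‿cong (*-congˡ (sumTo-cong< (suc n) (λ j j≤n →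
      *-congˡ (reflexive (bernTable-stable x (ℕP.≤-pred j≤n))))))))

  bern-recurrence : ∀ x → BernoulliRecurrence x (bern x)
  bern-recurrence x zero    = +-identityˡ _
  bern-recurrence x (suc n) = begin
      S + nat (suc (suc n) C suc n) * B (suc n) x
    ≈⟨ +-congˡ (*-cong (reflexive (≡.cong nat ([1+n]Cn≡1+n (suc n)))) (B-suc x n)) ⟩
      S + N * (pow x (suc n) - invSuc (suc n) * S)
    ≈⟨ +-congˡ (trans (distribˡ N _ _) (+-congˡ (sym (-‿distribʳ-* N _)))) ⟩
      S + (N * pow x (suc n) - N * (invSuc (suc n) * S))
    ≈⟨ +-congˡ (+-congˡ (-‿cong N[S/N]≈S)) ⟩
      S + (N * pow x (suc n) - S)
    ≈⟨ +-congˡ (+-comm _ _) ⟩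
      S + (- S + N * pow x (suc n))
    ≈⟨ +-assoc _ _ _ ⟨
      S - S + N * pow x (suc n)
    ≈⟨ trans (+-congʳ (-‿inverseʳ S)) (+-identityˡ _) ⟩
      N * pow x (suc n)
    ∎
    where
    open ≈-Reasoning
    S = sumTo (suc n) (λ k → nat (suc (suc n) C k) * B k x)
    N = nat (suc (suc n))
    N[S/N]≈S : N * (invSuc (suc n) * S) ≈ S
    N[S/N]≈S = trans (sym (*-assoc _ _ _)) (trans (*-congʳ (invSuc-inverseʳ (suc n))) (*-identityˡ S))

  recurrence⇒≋bern : ∀ {x Q} → BernoulliRecurrence x Q → Q ≋ bern x
  recurrence⇒≋bern {x} {Q} Q-rec n = agreeBelow (suc n) n (ℕP.n<1+n n)
    where
    open ≈-Reasoning
    agreeBelow : ∀ N k → k <ℕ N → Q k ≈ B k x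
    agreeBelow (suc N) k k<1+N with ℕP.m≤n⇒m<n∨m≡n (ℕP.≤-pred k<1+N)
    ... | inj₁ k<N    = agreeBelow N k k<N
    ... | inj₂ ≡.refl = nat-suc-*-cancelˡ N (∙-cancelˡ lower _ _ (begin
        lower + nat (suc N) * Q N
      ≈⟨ +-congˡ (*-congʳ (reflexive (≡.cong nat ([1+n]Cn≡1+n N)))) ⟨
        sumTo (suc N) (λ j → nat (suc N C j) * Q j)
      ≈⟨ trans (Q-rec N) (sym (bern-recurrence x N)) ⟩
        sumTo (suc N) (λ j → nat (suc N C j) * B j x)
      ≈⟨ +-cong (sumTo-cong< N (λ j j<N → *-congˡ (sym (agreeBelow N j j<N))))
                (*-congʳ (reflexive (≡.cong nat ([1+n]Cn≡1+n N)))) ⟩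
        lower + nat (suc N) * B N x
      ∎))
      where
      lower = sumTo N (λ j → nat (suc N C j) * Q j)

  ⋆-exp-1#-suc : ∀ Q m → (Q ⋆ exp 1#) (suc m) ≈ sumTo (suc m) (λ k → nat (suc m C k) * Q k) + Q (suc m)
  ⋆-exp-1#-suc Q m = +-cong
    (sumTo-cong (suc m) (λ k → trans (*-congˡ (pow-1# (suc m ∸ k))) (*-identityʳ _)))
    (trans (*-cong (*-congʳ (trans (reflexive (≡.cong nat (nCn≡1 (suc m)))) nat-1))
                   (reflexive (≡.cong (pow 1#) (ℕP.n∸n≡0 m))))
           (trans (*-identityʳ _) (*-identityˡ _)))

  isBernoulliEGF⇒recurrence : ∀ {x Q} → IsBernoulliEGF x Q → BernoulliRecurrence x Q
  isBernoulliEGF⇒recurrence {x} {Q} Q-egf m =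
    ∙-cancelʳ (Q (suc m)) _ _ (trans (sym (⋆-exp-1#-suc Q m)) (trans (Q-egf (suc m)) (+-comm _ _)))

  recurrence⇒isBernoulliEGF : ∀ {x Q} → BernoulliRecurrence x Q → IsBernoulliEGF x Q
  recurrence⇒isBernoulliEGF {x} {Q} Q-rec zero    =
    trans (+-identityˡ _) (trans (*-identityʳ _) (trans (*-congʳ nat-1) (trans (*-identityˡ _) (sym (+-identityʳ _)))))
  recurrence⇒isBernoulliEGF {x} {Q} Q-rec (suc m) =
    trans (⋆-exp-1#-suc Q m) (trans (+-congʳ (Q-rec m)) (+-comm _ _))

  bern-isBernoulliEGF : ∀ x → IsBernoulliEGF x (bern x)
  bern-isBernoulliEGF x = recurrence⇒isBernoulliEGF (bern-recurrence x)

  isBernoulliEGF⇒≋bern : ∀ {x Q} → IsBernoulliEGF x Q → Q ≋ bern x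
  isBernoulliEGF⇒≋bern Q-egf = recurrence⇒≋bern (isBernoulliEGF⇒recurrence Q-egf)

  bern-+ : ∀ x y → bern x ⋆ exp y ≋ bern (x + y)
  bern-+ x y = isBernoulliEGF⇒≋bern (begin
      bern x ⋆ exp y ⋆ exp 1#              ≈⟨ ⋆-assoc (bern x) (exp y) (exp 1#) ⟩
      bern x ⋆ (exp y ⋆ exp 1#)            ≈⟨ ⋆-congˡ (bern x) (⋆-comm (exp y) (exp 1#)) ⟩
      bern x ⋆ (exp 1# ⋆ exp y)            ≈⟨ ≋-sym (⋆-assoc (bern x) (exp 1#) (exp y)) ⟩
      bern x ⋆ exp 1# ⋆ exp y              ≈⟨ ⋆-congʳ (exp y) (bern-isBernoulliEGF x) ⟩
      (bern x ⊕ t* exp x) ⋆ exp y          ≈⟨ ⋆-distribʳ-⊕ (bern x) (t* exp x) (exp y) ⟩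
      bern x ⋆ exp y ⊕ (t* exp x) ⋆ exp y  ≈⟨ ⊕-cong ≋-refl (t*-⋆ (exp x) (exp y)) ⟩
      bern x ⋆ exp y ⊕ t* (exp x ⋆ exp y)  ≈⟨ ⊕-cong ≋-refl (t*-cong (exp-+ x y)) ⟩
      bern x ⋆ exp y ⊕ t* exp (x + y)      ∎)
    where open ≋-Reasoning

module Multiplication {c ℓ} (A : QAlgebra c ℓ) where
  open Arithmetic A
  open Sums A
  open EGF A
  open Bernoulli A
  open import Data.Nat as ℕ using (ℕ; suc)
  open QAlgebra A
  open ≋-Reasoning

  expSum : ℕ → Carrier → Seq
  expSum N v = sumSeq N (λ i → exp (v * nat i))

  dilate-bern-+ : ∀ s z c → dilate s (bern (z + c)) ≋ dilate s (bern z) ⋆ exp (s * c)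
  dilate-bern-+ s z c = begin
    dilate s (bern (z + c))             ≈⟨ dilate-cong refl (≋-sym (bern-+ z c)) ⟩
    dilate s (bern z ⋆ exp c)           ≈⟨ dilate-⋆ s (bern z) (exp c) ⟩
    dilate s (bern z) ⋆ dilate s (exp c) ≈⟨ ⋆-congˡ (dilate s (bern z)) (dilate-exp s c) ⟩
    dilate s (bern z) ⋆ exp (s * c)     ∎

  sumSeq-dilate-bern : ∀ N s v z (c : ℕ → Carrier) → (∀ i → s * c i ≈ v * nat i) →
    sumSeq N (λ i → dilate s (bern (z + c i))) ≋ dilate s (bern z) ⋆ expSum N v
  sumSeq-dilate-bern N s v z c sc≈vi = begin
      sumSeq N (λ i → dilate s (bern (z + c i)))
    ≈⟨ (λ n → sumTo-cong N (λ i → dilate-bern-+ s z (c i) n)) ⟩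
      sumSeq N (λ i → dilate s (bern z) ⋆ exp (s * c i))
    ≈⟨ ≋-sym (⋆-sumSeqʳ N (dilate s (bern z)) (λ i → exp (s * c i))) ⟩
      dilate s (bern z) ⋆ sumSeq N (λ i → exp (s * c i))
    ≈⟨ ⋆-congˡ (dilate s (bern z)) (λ n → sumTo-cong N (λ i → pow-cong n (sc≈vi i))) ⟩
      dilate s (bern z) ⋆ expSum N v
    ∎

  module _ (d : ℕ) (x : Carrier) where
    private
      u = nat (suc d)
      G = dilate u (bern x)
      P = sumSeq (suc d) (λ i → exp (nat i))
      P⁺ = sumSeq (suc d) (λ i → exp (nat (suc i)))

      P⋆exp1≋P⁺ : P ⋆ exp 1# ≋ P⁺
      P⋆exp1≋P⁺ = ≋-trans (⋆-sumSeqˡ (suc d) (λ i → exp (nat i)) (exp 1#))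
        (λ n → sumTo-cong (suc d) (λ i → trans (exp-+ (nat i) 1# n) (pow-cong n (sym (nat-suc i)))))

      G⋆expu : G ⋆ exp u ≋ G ⊕ dilate u (t* exp x)
      G⋆expu = begin
        G ⋆ exp u                         ≈⟨ ⋆-congˡ G (λ n → sym (trans (dilate-exp u 1# n) (pow-cong n (*-identityʳ u)))) ⟩
        G ⋆ dilate u (exp 1#)             ≈⟨ ≋-sym (dilate-⋆ u (bern x) (exp 1#)) ⟩
        dilate u (bern x ⋆ exp 1#)        ≈⟨ dilate-cong refl (bern-isBernoulliEGF x) ⟩
        dilate u (bern x ⊕ t* exp x)      ≈⟨ dilate-⊕ u (bern x) (t* exp x) ⟩
        G ⊕ dilate u (t* exp x)           ∎

      -- Telescoping: Σ_{i<W} e^{(i+1)t} + 1 = Σ_{i<W} e^{it} + e^{Wt}.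
      G⋆P⁺ : G ⋆ P⁺ ≋ G ⋆ P ⊕ dilate u (t* exp x)
      G⋆P⁺ = ⊕-cancelʳ G (begin
        G ⋆ P⁺ ⊕ G                         ≈⟨ ⊕-cong ≋-refl (≋-sym (≋-trans (⋆-congˡ G (exp-cong nat-0)) (⋆-identityʳ G))) ⟩
        G ⋆ P⁺ ⊕ G ⋆ exp (nat 0)           ≈⟨ ≋-sym (⋆-distribˡ-⊕ G P⁺ (exp (nat 0))) ⟩
        G ⋆ (P⁺ ⊕ exp (nat 0))             ≈⟨ ⋆-congˡ G (λ n → sumTo-telescope (suc d) (λ i → pow (nat i) n)) ⟩
        G ⋆ (P ⊕ exp u)                    ≈⟨ ⋆-distribˡ-⊕ G P (exp u) ⟩
        G ⋆ P ⊕ G ⋆ exp u                  ≈⟨ ⊕-cong ≋-refl G⋆expu ⟩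
        G ⋆ P ⊕ (G ⊕ dilate u (t* exp x))  ≈⟨ (λ n → trans (+-congˡ (+-comm _ _)) (sym (+-assoc _ _ _))) ⟩
        G ⋆ P ⊕ dilate u (t* exp x) ⊕ G    ∎)

    bern-multiplication : invSuc d · (G ⋆ P) ≋ bern (u * x)
    bern-multiplication = isBernoulliEGF⇒≋bern (begin
        invSuc d · (G ⋆ P) ⋆ exp 1#                       ≈⟨ ⋆-·ˡ (invSuc d) (G ⋆ P) (exp 1#) ⟩
        invSuc d · (G ⋆ P ⋆ exp 1#)                       ≈⟨ ·-cong refl (⋆-assoc G P (exp 1#)) ⟩
        invSuc d · (G ⋆ (P ⋆ exp 1#))                     ≈⟨ ·-cong refl (⋆-congˡ G P⋆exp1≋P⁺) ⟩
        invSuc d · (G ⋆ P⁺)                               ≈⟨ ·-cong refl G⋆P⁺ ⟩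
        invSuc d · (G ⋆ P ⊕ dilate u (t* exp x))          ≈⟨ ·-distrib-⊕ (invSuc d) (G ⋆ P) _ ⟩
        invSuc d · (G ⋆ P) ⊕ invSuc d · dilate u (t* exp x) ≈⟨ ⊕-cong ≋-refl t*-part ⟩
        invSuc d · (G ⋆ P) ⊕ t* exp (u * x)               ∎)
      where
      t*-part : invSuc d · dilate u (t* exp x) ≋ t* exp (u * x)
      t*-part = begin
        invSuc d · dilate u (t* exp x)         ≈⟨ ·-cong refl (dilate-t* u (exp x)) ⟩
        invSuc d · u · t* dilate u (exp x)     ≈⟨ (λ n → invSuc-*-nat-suc d _) ⟩
        t* dilate u (exp x)                    ≈⟨ t*-cong (dilate-exp u x) ⟩
        t* exp (u * x)                         ∎

  dilate-bern-multiplication : ∀ d v x →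
    dilate v (bern (nat (suc d) * x)) ≋ invSuc d · (dilate (v * nat (suc d)) (bern x) ⋆ expSum (suc d) v)
  dilate-bern-multiplication d v x = begin
      dilate v (bern (u * x))
    ≈⟨ dilate-cong refl (≋-sym (bern-multiplication d x)) ⟩
      dilate v (invSuc d · (dilate u (bern x) ⋆ P))
    ≈⟨ dilate-· v (invSuc d) _ ⟩
      invSuc d · dilate v (dilate u (bern x) ⋆ P)
    ≈⟨ ·-cong refl (dilate-⋆ v (dilate u (bern x)) P) ⟩
      invSuc d · (dilate v (dilate u (bern x)) ⋆ dilate v P)
    ≈⟨ ·-cong refl (⋆-cong (dilate-dilate v u (bern x))
                            (≋-trans (dilate-sumSeq v (suc d) (λ i → exp (nat i)))
                                     (λ n → sumTo-cong (suc d) (λ i → dilate-exp v (nat i) n)))) ⟩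
      invSuc d · (dilate (v * u) (bern x) ⋆ expSum (suc d) v)
    ∎
    where
    u = nat (suc d)
    P = sumSeq (suc d) (λ i → exp (nat i))

module Symmetry {c ℓ} (A : QAlgebra c ℓ) (y₁ y₂ : QAlgebra.Carrier A) where
  open Arithmetic A
  open Sums A
  open EGF A
  open Bernoulli A
  open Multiplication A
  open import Data.Nat as ℕ using (suc)
  open QAlgebra A
  open import Algebra.Solver.Ring.NaturalCoefficients.Default commutativeSemiring
    using (solve; _:=_; _:*_)
  open ≋-Reasoning

  bernProduct : ℕ → ℕ → Seq
  bernProduct W V = dilate (nat V) (bern (nat W * y₁)) ⋆ dilate (nat W) (bern (nat V * y₂))

  bernProduct-factor : ∀ d e → let u = nat (suc d); v = nat (suc e) in
    bernProduct (suc d) (suc e) ≋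
      (invSuc d * invSuc e) · ((dilate (v * u) (bern y₁) ⋆ dilate (u * v) (bern y₂))
                                ⋆ (expSum (suc d) v ⋆ expSum (suc e) u))
  bernProduct-factor d e = begin
      dilate v (bern (u * y₁)) ⋆ dilate u (bern (v * y₂))
    ≈⟨ ⋆-cong (dilate-bern-multiplication d v y₁) (dilate-bern-multiplication e u y₂) ⟩
      invSuc d · (b₁ ⋆ E₁) ⋆ invSuc e · (b₂ ⋆ E₂)
    ≈⟨ ⋆-·ˡ (invSuc d) (b₁ ⋆ E₁) (invSuc e · (b₂ ⋆ E₂)) ⟩
      invSuc d · ((b₁ ⋆ E₁) ⋆ invSuc e · (b₂ ⋆ E₂))
    ≈⟨ ·-cong refl (⋆-·ʳ (invSuc e) (b₁ ⋆ E₁) (b₂ ⋆ E₂)) ⟩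
      invSuc d · invSuc e · ((b₁ ⋆ E₁) ⋆ (b₂ ⋆ E₂))
    ≈⟨ ·-assoc (invSuc d) (invSuc e) ((b₁ ⋆ E₁) ⋆ (b₂ ⋆ E₂)) ⟩
      (invSuc d * invSuc e) · ((b₁ ⋆ E₁) ⋆ (b₂ ⋆ E₂))
    ≈⟨ ·-cong refl (⋆-four-swap b₁ E₁ b₂ E₂) ⟩
      (invSuc d * invSuc e) · ((b₁ ⋆ b₂) ⋆ (E₁ ⋆ E₂))
    ∎
    where
    u = nat (suc d)
    v = nat (suc e)
    b₁ = dilate (v * u) (bern y₁)
    b₂ = dilate (u * v) (bern y₂)
    E₁ = expSum (suc d) v
    E₂ = expSum (suc e) u

  bernProduct-comm : ∀ d e → bernProduct (suc d) (suc e) ≋ bernProduct (suc e) (suc d)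
  bernProduct-comm d e = begin
      bernProduct (suc d) (suc e)
    ≈⟨ bernProduct-factor d e ⟩
      (invSuc d * invSuc e) · ((dilate (v * u) (bern y₁) ⋆ dilate (u * v) (bern y₂))
                                ⋆ (expSum (suc d) v ⋆ expSum (suc e) u))
    ≈⟨ ·-cong (*-comm _ _) (⋆-cong (⋆-cong (dilate-congʳ (bern y₁) (*-comm v u))
                                           (dilate-congʳ (bern y₂) (*-comm u v)))
                                   (⋆-comm (expSum (suc d) v) (expSum (suc e) u))) ⟩
      (invSuc e * invSuc d) · ((dilate (u * v) (bern y₁) ⋆ dilate (v * u) (bern y₂))
                                ⋆ (expSum (suc e) u ⋆ expSum (suc d) v))
    ≈⟨ ≋-sym (bernProduct-factor e d) ⟩
      bernProduct (suc e) (suc d)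
    ∎
    where
    u = nat (suc d)
    v = nat (suc e)

  ⋆-weightˡ : ∀ V a b n → sumUpTo n (λ k → nat (n C k) * a k * b (n ∸ k) * nat (V ^ k)) ≈ (dilate (nat V) a ⋆ b) n
  ⋆-weightˡ V a b n = sumTo-cong (suc n) (λ k → trans (*-congˡ (nat-^ V k))
    (solve 4 (λ c x y p → c :* x :* y :* p := c :* (p :* x) :* y) refl _ _ _ _))

  ⋆-weightʳ : ∀ V a b n → sumUpTo n (λ k → nat (n C k) * a k * b (n ∸ k) * nat (V ^ (n ∸ k))) ≈ (a ⋆ dilate (nat V) b) n
  ⋆-weightʳ V a b n = sumTo-cong (suc n) (λ k → trans (*-congˡ (nat-^ V (n ∸ k)))
    (solve 4 (λ c x y p → c :* x :* y :* p := c :* x :* (p :* y)) refl _ _ _ _))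

  powPred-⋆ : ∀ d a b n → let u = nat (suc d) in
    ι (powPred (suc d) n) * (a ⋆ b) n ≈ (invSuc d · (dilate u a ⋆ dilate u b)) n
  powPred-⋆ d a b n = trans (*-congʳ (ι-powPred d n)) (trans (*-assoc _ _ _) (*-congˡ (dilate-⋆ (nat (suc d)) a b n)))

  bernProduct-coefficient : ∀ W V n →
    sumUpTo n (λ k → nat (n C k) * B k (nat W * y₁) * B (n ∸ k) (nat V * y₂) * nat (W ^ (n ∸ k)) * nat (V ^ k))
      ≈ bernProduct W V n
  bernProduct-coefficient W V n = sumTo-cong (suc n) (λ k →
    trans (*-cong (*-congˡ (nat-^ W (n ∸ k))) (nat-^ V k))
          (solve 5 (λ c x y p q → c :* x :* y :* p :* q := c :* (q :* x) :* (p :* y)) refl _ _ _ _ _))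

  bernProduct-multiplicationˡ : ∀ d V n →
    ι (powPred (suc d) n) * sumUpTo n (λ k → nat (n C k) * B k y₁
      * sumTo (suc d) (λ i → B (n ∸ k) (nat V * y₂ + ι (fracℚ (V *ℕ i) (suc d)))) * nat (V ^ k))
      ≈ bernProduct (suc d) V n
  bernProduct-multiplicationˡ d V n =
    trans (*-congˡ (⋆-weightˡ V (bern y₁) Q n)) (trans (powPred-⋆ d (dilate v (bern y₁)) Q n) (egf n))
    where
    u = nat (suc d)
    v = nat V
    Q = sumSeq (suc d) (λ i → bern (v * y₂ + ι (fracℚ (V *ℕ i) (suc d))))
    b₁ = dilate (v * u) (bern y₁)
    b₂ = dilate u (bern (v * y₂))
    E = expSum (suc d) v
    egf : invSuc d · (dilate u (dilate v (bern y₁)) ⋆ dilate u Q) ≋ bernProduct (suc d) V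
    egf = begin
        invSuc d · (dilate u (dilate v (bern y₁)) ⋆ dilate u Q)
      ≈⟨ ·-cong refl (⋆-cong (≋-trans (dilate-dilate u v (bern y₁)) (dilate-congʳ (bern y₁) (*-comm u v)))
                             (≋-trans (dilate-sumSeq u (suc d) _)
                                      (sumSeq-dilate-bern (suc d) u v (v * y₂) _ (λ i →
                                         trans (nat-suc-*-ι-fracℚ (V *ℕ i) d) (nat-* V i))))) ⟩
        invSuc d · (dilate (v * u) (bern y₁) ⋆ (dilate u (bern (v * y₂)) ⋆ expSum (suc d) v))
      ≈⟨ ·-cong refl (≋-trans (⋆-congˡ b₁ (⋆-comm b₂ E)) (≋-sym (⋆-assoc b₁ E b₂))) ⟩
        invSuc d · (dilate (v * u) (bern y₁) ⋆ expSum (suc d) v ⋆ dilate u (bern (v * y₂)))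
      ≈⟨ ≋-sym (⋆-·ˡ (invSuc d) (b₁ ⋆ E) b₂) ⟩
        invSuc d · (dilate (v * u) (bern y₁) ⋆ expSum (suc d) v) ⋆ dilate u (bern (v * y₂))
      ≈⟨ ⋆-congʳ (dilate u (bern (v * y₂))) (≋-sym (dilate-bern-multiplication d v y₁)) ⟩
        bernProduct (suc d) V
      ∎

  bernProduct-multiplicationʳ : ∀ d V n →
    ι (powPred (suc d) n) * sumUpTo n (λ k → nat (n C k) * B k (nat V * y₁)
      * sumTo (suc d) (λ i → B (n ∸ k) (y₂ + ι (fracℚ i (suc d)))) * nat (V ^ (n ∸ k)))
      ≈ bernProduct V (suc d) n
  bernProduct-multiplicationʳ d V n =
    trans (*-congˡ (⋆-weightʳ V (bern (v * y₁)) R n)) (trans (powPred-⋆ d (bern (v * y₁)) (dilate v R) n) (egf n))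
    where
    u = nat (suc d)
    v = nat V
    R = sumSeq (suc d) (λ i → bern (y₂ + ι (fracℚ i (suc d))))
    egf : invSuc d · (dilate u (bern (v * y₁)) ⋆ dilate u (dilate v R)) ≋ bernProduct V (suc d)
    egf = begin
        invSuc d · (dilate u (bern (v * y₁)) ⋆ dilate u (dilate v R))
      ≈⟨ ·-cong refl (⋆-congˡ (dilate u (bern (v * y₁)))
           (≋-trans (dilate-dilate u v R) (≋-trans (dilate-congʳ R (*-comm u v))
             (≋-trans (dilate-sumSeq (v * u) (suc d) _)
                      (sumSeq-dilate-bern (suc d) (v * u) v y₂ _ (λ i →
                         trans (*-assoc v u _) (*-congˡ (nat-suc-*-ι-fracℚ i d)))))))) ⟩
        invSuc d · (dilate u (bern (v * y₁)) ⋆ (dilate (v * u) (bern y₂) ⋆ expSum (suc d) v))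
      ≈⟨ ≋-sym (⋆-·ʳ (invSuc d) (dilate u (bern (v * y₁))) (dilate (v * u) (bern y₂) ⋆ expSum (suc d) v)) ⟩
        dilate u (bern (v * y₁)) ⋆ invSuc d · (dilate (v * u) (bern y₂) ⋆ expSum (suc d) v)
      ≈⟨ ⋆-congˡ (dilate u (bern (v * y₁))) (≋-sym (dilate-bern-multiplication d v y₂)) ⟩
        bernProduct V (suc d)
      ∎

corollary6 : ∀ {c ℓ} (A : QAlgebra c ℓ) → let open QAlgebra A in
  (p : ℕ) → Prime p →
  (w₁ w₂ : ℕ) → {{_ : NonZero w₁}} → {{_ : NonZero w₂}} →
  (y₁ y₂ : Carrier) → (n : ℕ) →
  (sumUpTo n (λ k → ι (natℚ (n C k)) * B k (ι (natℚ w₁) * y₁) * B (n ∸ k) (ι (natℚ w₂) * y₂)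
      * ι (natℚ (w₁ ^ (n ∸ k))) * ι (natℚ (w₂ ^ k)))
   ≈ sumUpTo n (λ k → ι (natℚ (n C k)) * B k (ι (natℚ w₂) * y₁) * B (n ∸ k) (ι (natℚ w₁) * y₂)
      * ι (natℚ (w₂ ^ (n ∸ k))) * ι (natℚ (w₁ ^ k))))
  × (sumUpTo n (λ k → ι (natℚ (n C k)) * B k (ι (natℚ w₂) * y₁) * B (n ∸ k) (ι (natℚ w₁) * y₂)
      * ι (natℚ (w₂ ^ (n ∸ k))) * ι (natℚ (w₁ ^ k)))
   ≈ ι (powPred w₁ n) * sumUpTo n (λ k → ι (natℚ (n C k)) * B k y₁
      * sumTo w₁ (λ i → B (n ∸ k) (ι (natℚ w₂) * y₂ + ι (fracℚ (w₂ *ℕ i) w₁)))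
      * ι (natℚ (w₂ ^ k))))
  × (ι (powPred w₁ n) * sumUpTo n (λ k → ι (natℚ (n C k)) * B k y₁
      * sumTo w₁ (λ i → B (n ∸ k) (ι (natℚ w₂) * y₂ + ι (fracℚ (w₂ *ℕ i) w₁)))
      * ι (natℚ (w₂ ^ k)))
   ≈ ι (powPred w₁ n) * sumUpTo n (λ k → ι (natℚ (n C k)) * B k (ι (natℚ w₂) * y₁)
      * sumTo w₁ (λ i → B (n ∸ k) (y₂ + ι (fracℚ i w₁)))
      * ι (natℚ (w₂ ^ (n ∸ k)))))
  × (ι (powPred w₁ n) * sumUpTo n (λ k → ι (natℚ (n C k)) * B k (ι (natℚ w₂) * y₁)
      * sumTo w₁ (λ i → B (n ∸ k) (y₂ + ι (fracℚ i w₁)))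
      * ι (natℚ (w₂ ^ (n ∸ k))))
   ≈ ι (powPred w₂ n) * sumUpTo n (λ k → ι (natℚ (n C k)) * B k y₁
      * sumTo w₂ (λ i → B (n ∸ k) (ι (natℚ w₁) * y₂ + ι (fracℚ (w₁ *ℕ i) w₂)))
      * ι (natℚ (w₁ ^ k))))
  × (ι (powPred w₂ n) * sumUpTo n (λ k → ι (natℚ (n C k)) * B k y₁
      * sumTo w₂ (λ i → B (n ∸ k) (ι (natℚ w₁) * y₂ + ι (fracℚ (w₁ *ℕ i) w₂)))
      * ι (natℚ (w₁ ^ k)))
   ≈ ι (powPred w₂ n) * sumUpTo n (λ k → ι (natℚ (n C k)) * B k (ι (natℚ w₁) * y₁)
      * sumTo w₂ (λ i → B (n ∸ k) (y₂ + ι (fracℚ i w₂)))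
      * ι (natℚ (w₁ ^ (n ∸ k)))))

corollary6 A _ _ (suc d₁) (suc d₂) y₁ y₂ n =
    trans (bernProduct-coefficient w₁ w₂ n) (trans swap (sym (bernProduct-coefficient w₂ w₁ n)))
  , trans (bernProduct-coefficient w₂ w₁ n) (trans (sym swap) (sym (bernProduct-multiplicationˡ d₁ w₂ n)))
  , trans (bernProduct-multiplicationˡ d₁ w₂ n) (trans swap (sym (bernProduct-multiplicationʳ d₁ w₂ n)))
  , trans (bernProduct-multiplicationʳ d₁ w₂ n) (sym (bernProduct-multiplicationˡ d₂ w₁ n))
  , trans (bernProduct-multiplicationˡ d₂ w₁ n) (trans (sym swap) (sym (bernProduct-multiplicationʳ d₂ w₁ n)))
  where
  open QAlgebra A
  open Symmetry A y₁ y₂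
  w₁ = suc d₁
  w₂ = suc d₂
  swap : bernProduct w₁ w₂ n ≈ bernProduct w₂ w₁ n
  swap = bernProduct-comm d₁ d₂ n
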